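{- Let $\mathcal{P}$ be a two-orbit $n$-polytope in the class $2_I$, with $I\subsetneq N:=\{0,\ldots,n-1\}$, and let $\Omega$ be a chain of $\mathcal{P}$. Let $t(\Omega)$ denote the set of ranks of the proper faces in $\Omega$ (faces of rank in $N$), and suppose that $N\setminus I\subseteq t(\Omega)$. Then any two flags of $\mathcal{P}$ containing $\Omega$ lie in the same orbit under $\Gamma(\mathcal{P})$.
   Context: An (abstract) polytope of rank $n$ is a partially ordered set $\mathcal{P}$ with a strictly monotone rank function onto $\{ -1,\ldots,n\}$, with a unique least face (rank $-1$) and unique greatest face (rank $n$), whose maximal chains (flags) each contain exactly $n+2$ faces, satisfying the diamond condition (if $F\le G$ with ranks $j-1$ and $j+1$, $0\le j\le n-1$, there are exactly two $j$-faces between them) and strongly flag-connected (any two flags $\Phi,\Psi$ are joined by a sequence of flags, all containing $\Phi\cap\Psi$, successive ones differing in exactly one face). For a flag $\Phi$ and $i\in N=\{0,\ldots,n-1\}$, $\Phi^i$ is the unique flag differing from $\Phi$ exactly in its $i$-face. $\Gamma(\mathcal{P})$ is the group of automorphisms (order-preserving bijections with order-preserving inverse). $\mathcal{P}$ is a two-orbit polytope if $\Gamma(\mathcal{P})$ has exactly two orbits on flags. For such $\mathcal{P}$, the set $I$ of those $i\in N$ for which a flag $\Phi$ and $\Phi^i$ lie in the same $\Gamma(\mathcal{P})$-orbit does not depend on $\Phi$; it is a proper subset of $N$, and $\mathcal{P}$ is said to belong to the class $2_I$. -}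

module Defs where

open import Data.Nat using (ℕ; suc)
open import Data.Fin using (Fin; toℕ; inject₁) renaming (_<_ to _<ᶠ_)
import Data.Fin as Fin
open import Data.Fin.Subset using (Subset; _∈_; _∉_)
open import Data.Product using (Σ; ∃; _×_; _,_)
open import Data.Sum using (_⊎_)
open import Relation.Nullary using (¬_)
open import Relation.Binary.PropositionalEquality using (_≡_; _≢_)
open import Function.Bundles using (_⇔_)

-- Convention: a rank r ∈ {-1,…,n} of the paper is encoded as the index
-- r+1 ∈ Fin (n+2).  A paper rank i ∈ N = {0,…,n-1} is thus the index
-- suc (inject₁ i).
properIdx : ∀ {n} → Fin n → Fin (suc (suc n))
properIdx i = Fin.suc (inject₁ i)

record RankedPoset (n : ℕ) : Set₁ where
  field
    Face    : Set
    _≤_     : Face → Face → Set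
    ≤-refl  : ∀ {x} → x ≤ x
    ≤-trans : ∀ {x y z} → x ≤ y → y ≤ z → x ≤ z
    ≤-antisym : ∀ {x y} → x ≤ y → y ≤ x → x ≡ y
    rank    : Face → Fin (suc (suc n))
    rank-strict : ∀ {x y} → x ≤ y → x ≢ y → rank x <ᶠ rank y
    rank-onto : ∀ (k : Fin (suc (suc n))) → ∃ λ x → rank x ≡ k
    least    : Face
    least-≤  : ∀ x → least ≤ x
    greatest : Face
    ≤-greatest : ∀ x → x ≤ greatest

  Comparable : Face → Face → Set
  Comparable x y = x ≤ y ⊎ y ≤ x

  IsChain : (Face → Set) → Set
  IsChain C = ∀ x y → C x → C y → Comparable x y

  IsMaximalChain : (Face → Set) → Set
  IsMaximalChain C = IsChain C × (∀ x → (∀ y → C y → Comparable x y) → C x)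

  -- A flag, given by its faces F_{-1},…,F_n (a maximal chain, cf. maximal-chain-full).
  record Flag : Set where
    field
      face      : Fin (suc (suc n)) → Face
      face-rank : ∀ k → rank (face k) ≡ k
      face-mono : ∀ k l → k Fin.≤ l → face k ≤ face l
  open Flag public

  DifferExactlyAt : Fin (suc (suc n)) → Flag → Flag → Set
  DifferExactlyAt k Φ Ψ = face Φ k ≢ face Ψ k × (∀ l → l ≢ k → face Φ l ≡ face Ψ l)

  Adjacent : Flag → Flag → Set
  Adjacent Φ Ψ = ∃ λ k → DifferExactlyAt k Φ Ψ

  IsIAdjacent : Fin n → Flag → Flag → Set
  IsIAdjacent i Φ Ψ = DifferExactlyAt (properIdx i) Φ Ψ

  ContainsMeet : Flag → Flag → Flag → Set
  ContainsMeet Φ Ψ Χ = ∀ k → face Φ k ≡ face Ψ k → face Χ k ≡ face Φ k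

  data FlagPath (P : Flag → Set) : Flag → Flag → Set where
    here : ∀ {Φ} → P Φ → FlagPath P Φ Φ
    step : ∀ {Φ Χ Ψ} → P Φ → Adjacent Φ Χ → FlagPath P Χ Ψ → FlagPath P Φ Ψ

  record Automorphism : Set where
    field
      to       : Face → Face
      from     : Face → Face
      to-from  : ∀ x → to (from x) ≡ x
      from-to  : ∀ x → from (to x) ≡ x
      to-mono  : ∀ {x y} → x ≤ y → to x ≤ to y
      from-mono : ∀ {x y} → x ≤ y → from x ≤ from y

  SameOrbit : Flag → Flag → Set
  SameOrbit Φ Ψ = Σ Automorphism λ γ → ∀ k → Automorphism.to γ (face Φ k) ≡ face Ψ k

  IsTwoOrbit : Set
  IsTwoOrbit = Σ Flag λ Φ₀ → Σ Flag λ Φ₁ → ¬ SameOrbit Φ₀ Φ₁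
    × (∀ Ψ → SameOrbit Φ₀ Ψ ⊎ SameOrbit Φ₁ Ψ)

  InClass2 : Subset n → Set
  InClass2 I = (∃ λ i → i ∉ I)
    × (∀ (i : Fin n) Φ Ψ → IsIAdjacent i Φ Ψ → (i ∈ I ⇔ SameOrbit Φ Ψ))

  FlagContains : Flag → (Face → Set) → Set
  FlagContains Φ Ω = ∀ x → Ω x → face Φ (rank x) ≡ x

  ComplementInType : Subset n → (Face → Set) → Set
  ComplementInType I Ω = ∀ (i : Fin n) → i ∉ I → ∃ λ x → Ω x × rank x ≡ properIdx i

record IsPolytope {n : ℕ} (P : RankedPoset n) : Set₁ where
  open RankedPoset P
  field
    -- every maximal chain contains exactly n+2 faces; since the rank is strictly
    -- monotone, a chain has at most one face of each rank, so this says that a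
    -- maximal chain has a face of every rank -1,…,n.
    maximal-chain-full : ∀ C → IsMaximalChain C →
      ∀ (k : Fin (suc (suc n))) → ∃ λ x → C x × rank x ≡ k
    diamond : ∀ x y → x ≤ y → toℕ (rank y) ≡ suc (suc (toℕ (rank x))) →
      Σ Face λ a → Σ Face λ b → a ≢ b
        × (x ≤ a × a ≤ y × toℕ (rank a) ≡ suc (toℕ (rank x)))
        × (x ≤ b × b ≤ y × toℕ (rank b) ≡ suc (toℕ (rank x)))
        × (∀ z → x ≤ z → z ≤ y → toℕ (rank z) ≡ suc (toℕ (rank x)) → z ≡ a ⊎ z ≡ b)

    strongly-flag-connected : ∀ Φ Ψ → FlagPath (ContainsMeet Φ Ψ) Φ Ψ

-- Strong flag-connectivity joins Φ and Ψ by a path of flags all containing Φ ∩ Ψ ⊇ Ω,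
-- so no step of the path can change a face of rank in N ∖ I ⊆ t(Ω). Each step is an
-- i-adjacency (the least and greatest faces are unique), hence has i ∈ I and joins
-- flags of the same orbit.
module Submission where

open import Defs
open import Data.Nat using (ℕ; suc)
open import Data.Nat.Properties using (n≮0; <⇒≱)
open import Data.Fin using (Fin; fromℕ)
open import Data.Fin.Properties using (≤fromℕ)
open import Data.Fin.Relation.Unary.Top using (view; ‵fromℕ; ‵inject₁)
open import Data.Fin.Subset using (Subset; _∉_)
open import Data.Fin.Subset.Properties using (_∈?_)
open import Data.Product using (∃; _,_)
open import Data.Empty using (⊥-elim)
open import Function.Bundles using (Equivalence)
open import Relation.Nullary using (¬_; yes; no)
open import Relation.Binary.PropositionalEquality using (_≡_; _≢_; refl; sym; trans; cong; subst)

¬≢-shared : ∀ {A : Set} {a b c : A} → ¬ a ≢ c → ¬ b ≢ c → ¬ a ≢ b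
¬≢-shared ¬a≢c ¬b≢c a≢b = ¬a≢c λ a≡c → ¬b≢c λ b≡c → a≢b (trans a≡c (sym b≡c))

module FlagOrbits {n : ℕ} (P : RankedPoset n) where
  open RankedPoset P
  open Automorphism

  id-automorphism : Automorphism
  id-automorphism = record
    { to = λ x → x ; from = λ x → x
    ; to-from = λ _ → refl ; from-to = λ _ → refl
    ; to-mono = λ x≤y → x≤y ; from-mono = λ x≤y → x≤y
    }

  _∘-automorphism_ : Automorphism → Automorphism → Automorphism
  δ ∘-automorphism γ = record
    { to = λ x → to δ (to γ x)
    ; from = λ x → from γ (from δ x)
    ; to-from = λ x → trans (cong (to δ) (to-from γ _)) (to-from δ x)
    ; from-to = λ x → trans (cong (from γ) (from-to δ _)) (from-to γ x)
    ; to-mono = λ x≤y → to-mono δ (to-mono γ x≤y)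
    ; from-mono = λ x≤y → from-mono γ (from-mono δ x≤y)
    }

  sameOrbit-refl : ∀ Φ → SameOrbit Φ Φ
  sameOrbit-refl Φ = id-automorphism , λ _ → refl

  sameOrbit-trans : ∀ {Φ Χ Ψ} → SameOrbit Φ Χ → SameOrbit Χ Ψ → SameOrbit Φ Ψ
  sameOrbit-trans (γ , γΦ≡Χ) (δ , δΧ≡Ψ) =
    δ ∘-automorphism γ , λ k → trans (cong (to δ) (γΦ≡Χ k)) (δΧ≡Ψ k)

  -- Only ¬¬-equality: strict monotonicity of the rank applies to faces known to be distinct.
  rank-zero⇒¬≢least : ∀ {x} → rank x ≡ Fin.zero → ¬ x ≢ least
  rank-zero⇒¬≢least {x} rank≡0 x≢least
    with rank-strict (least-≤ x) (λ least≡x → x≢least (sym least≡x))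
  ... | lt rewrite rank≡0 = n≮0 lt

  rank-top⇒¬≢greatest : ∀ {x} → rank x ≡ fromℕ (suc n) → ¬ x ≢ greatest
  rank-top⇒¬≢greatest {x} rank≡top x≢greatest
    with rank-strict (≤-greatest x) x≢greatest
  ... | lt rewrite rank≡top = <⇒≱ lt (≤fromℕ (rank greatest))

  differExactlyAt⇒iAdjacent : ∀ k {Φ Ψ} → DifferExactlyAt k Φ Ψ → ∃ λ i → IsIAdjacent i Φ Ψ
  differExactlyAt⇒iAdjacent Fin.zero {Φ} {Ψ} (Φ≢Ψ , _) = ⊥-elim (¬≢-shared
    (rank-zero⇒¬≢least (face-rank Φ Fin.zero)) (rank-zero⇒¬≢least (face-rank Ψ Fin.zero)) Φ≢Ψ)
  differExactlyAt⇒iAdjacent (Fin.suc k) {Φ} {Ψ} differ@(Φ≢Ψ , _) with view k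
  ... | ‵inject₁ i = i , differ
  ... | ‵fromℕ = ⊥-elim (¬≢-shared
    (rank-top⇒¬≢greatest (face-rank Φ _)) (rank-top⇒¬≢greatest (face-rank Ψ _)) Φ≢Ψ)

  adjacent⇒iAdjacent : ∀ {Φ Ψ} → Adjacent Φ Ψ → ∃ λ i → IsIAdjacent i Φ Ψ
  adjacent⇒iAdjacent {Φ} {Ψ} (k , differ) = differExactlyAt⇒iAdjacent k {Φ} {Ψ} differ

  flagPath-head : ∀ {Q : Flag → Set} {Φ Ψ} → FlagPath Q Φ Ψ → Q Φ
  flagPath-head (here QΦ) = QΦ
  flagPath-head (step QΦ _ _) = QΦ

  flagPath⇒sameOrbit : ∀ {Q : Flag → Set} → (∀ {Φ Ψ} → Q Φ → Q Ψ → Adjacent Φ Ψ → SameOrbit Φ Ψ) →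
    ∀ {Φ Ψ} → FlagPath Q Φ Ψ → SameOrbit Φ Ψ
  flagPath⇒sameOrbit adjacent⇒sameOrbit (here {Φ} _) = sameOrbit-refl Φ
  flagPath⇒sameOrbit adjacent⇒sameOrbit (step {Φ} {Χ} {Ψ} QΦ Φ~Χ Χ⇝Ψ) =
    sameOrbit-trans {Φ} {Χ} {Ψ}
      (adjacent⇒sameOrbit {Φ} {Χ} QΦ (flagPath-head Χ⇝Ψ) Φ~Χ)
      (flagPath⇒sameOrbit adjacent⇒sameOrbit Χ⇝Ψ)

module Class2 {n : ℕ} (P : RankedPoset n) (I : Subset n) where
  open RankedPoset P
  open FlagOrbits P

  AgreeOff : Flag → Flag → Set
  AgreeOff Φ Ψ = ∀ i → i ∉ I → face Φ (properIdx i) ≡ face Ψ (properIdx i)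

  flagsContaining⇒agreeOff : ∀ {Ω Φ Ψ} → ComplementInType I Ω →
    FlagContains Φ Ω → FlagContains Ψ Ω → AgreeOff Φ Ψ
  flagsContaining⇒agreeOff {Φ = Φ} {Ψ} Ω-covers Φ⊇Ω Ψ⊇Ω i i∉I with Ω-covers i i∉I
  ... | x , Ωx , rank≡i =
    subst (λ k → face Φ k ≡ face Ψ k) rank≡i (trans (Φ⊇Ω x Ωx) (sym (Ψ⊇Ω x Ωx)))

  containsMeet⇒agreeOff : ∀ {Φ Ψ Χ Χ′} → AgreeOff Φ Ψ →
    ContainsMeet Φ Ψ Χ → ContainsMeet Φ Ψ Χ′ → AgreeOff Χ Χ′
  containsMeet⇒agreeOff Φ≈Ψ Χ⊇Φ∩Ψ Χ′⊇Φ∩Ψ i i∉I =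
    trans (Χ⊇Φ∩Ψ _ (Φ≈Ψ i i∉I)) (sym (Χ′⊇Φ∩Ψ _ (Φ≈Ψ i i∉I)))

  adjacent-agreeOff⇒sameOrbit : ∀ {Φ Ψ} → InClass2 I →
    AgreeOff Φ Ψ → Adjacent Φ Ψ → SameOrbit Φ Ψ
  adjacent-agreeOff⇒sameOrbit {Φ} {Ψ} (_ , i-adjacency) Φ≈Ψ Φ~Ψ
    with adjacent⇒iAdjacent {Φ} {Ψ} Φ~Ψ
  ... | i , (Φ≢Ψ , rest) with i ∈? I
  ...   | yes i∈I = Equivalence.to (i-adjacency i Φ Ψ (Φ≢Ψ , rest)) i∈I
  ...   | no i∉I = ⊥-elim (Φ≢Ψ (Φ≈Ψ i i∉I))

lemma3 : ∀ {n : ℕ} (P : RankedPoset n) → IsPolytope P → (I : Subset n) →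
    RankedPoset.IsTwoOrbit P → RankedPoset.InClass2 P I →
    ∀ (Ω : RankedPoset.Face P → Set) → RankedPoset.IsChain P Ω →
    RankedPoset.ComplementInType P I Ω →
    ∀ (Φ Ψ : RankedPoset.Flag P) →
    RankedPoset.FlagContains P Φ Ω → RankedPoset.FlagContains P Ψ Ω →
    RankedPoset.SameOrbit P Φ Ψ
lemma3 P polytope I _ class2 Ω _ Ω-covers Φ Ψ Φ⊇Ω Ψ⊇Ω =
  flagPath⇒sameOrbit
    (λ {Χ} {Χ′} Χ⊇Φ∩Ψ Χ′⊇Φ∩Ψ → adjacent-agreeOff⇒sameOrbit {Χ} {Χ′} class2
      (containsMeet⇒agreeOff {Φ} {Ψ} {Χ} {Χ′} Φ≈Ψ Χ⊇Φ∩Ψ Χ′⊇Φ∩Ψ))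
    (IsPolytope.strongly-flag-connected polytope Φ Ψ)
  where
    open FlagOrbits P
    open Class2 P I
    Φ≈Ψ : AgreeOff Φ Ψ
    Φ≈Ψ = flagsContaining⇒agreeOff {Φ = Φ} {Ψ} Ω-covers Φ⊇Ω Ψ⊇Ω
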